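{- Let $A \equiv K \Rightarrow F$ be a regular formula, where $K \equiv B_1 \land \ldots \land B_k$ is a basic context with conjuncts $B_1,\ldots,B_k$ (basic formulas) and $F$ is a variable or $\bot$. Let $d = d(A)$ be the number of conjuncts $B_i$ of the form $(P \Rightarrow E) \Rightarrow R$, where $P, R$ are variables and $E$ is a variable or $\bot$. Then either $\mathbf{IPL} \vdash A$, or $A$ has a strong refutation in $\mathfrak{J}_d$, i.e., there is an interpretation $I$ in $\mathfrak{J}_d$ with $V_I(K) = \mathsf{t}$ and $V_I(F) \neq \mathsf{t}$.
   Context: Formulas of intuitionistic propositional logic $\mathbf{IPL}$ are built from variables $P_1,P_2,\ldots$, constants $\bot,\top$ and binary connectives $\land,\lor,\Rightarrow$; $\lnot A$ abbreviates $A \Rightarrow \bot$, and $A \Leftrightarrow B$ abbreviates $(A\Rightarrow B)\land(B \Rightarrow A)$. $\mathbf{IPL}\vdash A$ means $A$ is provable in intuitionistic propositional logic. Given a Heyting algebra $\mathbf{H}$ and an interpretation $I$ mapping variables to elements of $H$, $V_I$ extends $I$ to all formulas by interpreting $\bot,\top,\land,\lor,\Rightarrow$ as $\mathsf{f},\mathsf{t},\sqcap,\sqcup,\rightarrow$. A formula is reduced if $\top$ does not occur as an operand of any connective and $\bot$ occurs as an operand only as the right-hand operand of $\Rightarrow$. A formula is basic if it is reduced and is either a variable or has the form $P \Rightarrow A$ or $A \Rightarrow P$ with $P$ a variable and $A$ a formula containing at most one connective (so the basic forms are $P$, $P\Rightarrow Q$, $P\Rightarrow Q\land R$, $P \Rightarrow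 Q\lor R$, $P\Rightarrow Q\Rightarrow R$, $P \Rightarrow \lnot Q$, $\lnot P$, $P\land Q\Rightarrow R$, $P\lor Q \Rightarrow R$, $(P\Rightarrow Q)\Rightarrow R$, $\lnot P \Rightarrow Q$, with $P,Q,R$ variables). A basic context is a reduced formula that is a conjunction of one or more pairwise distinct basic formulas. A regular formula is an implication $K \Rightarrow F$ with $K$ a basic context and $F$ a variable or $\bot$. Construction $\Gamma$: for a Heyting algebra $\mathbf{H}=(H,\mathsf{f},\mathsf{t},\sqcap,\sqcup,\rightarrow)$, $\Gamma(\mathbf{H})$ is the Heyting algebra on $H\cup\{*\}$ ($*$ a new element) in which $x < * < \mathsf{t}$ for all $x \in H\setminus\{\mathsf{t}\}$. Writing $\alpha: H \to (H\setminus\{\mathsf{t}\})\cup\{*\}$ with $\alpha(x)=x$ for $x\ne\mathsf{t}$ and $\alpha(\mathsf{t})=*$, the operations are, for $x,y\in H\setminus\{\mathsf{t}\}$: $x\sqcap y$ as in $\mathbf{H}$, $x\sqcap * = x$, $*\sqcap*=*$, $\mathsf{t}$ is the unit for $\sqcap$; $x \sqcup y = \alpha(x\sqcup_{\mathbf{H}} y)$, $x\sqcup * = *\sqcup *=*$, anything joined with $\mathsf{t}$ is $\mathsf{t}$; $x\rightarrow y$ as in $\mathbf{H}$, $x \rightarrow * = x\rightarrow\mathsf{t} = \mathsf{t}$, $*\rightarrow y = y$, $*\rightarrow * = *\rightarrow\mathsf{t}=\mathsf{t}$, $\mathsf{t}\rightarrow y = y$, $\mathsf{t}\rightarrow * =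 *$, $\mathsf{t}\rightarrow\mathsf{t}=\mathsf{t}$ (all operations commutative where applicable). Let $\mathbb{B}$ be the two-element Heyting algebra and $\mathbf{H}^i$ the $i$-fold direct power. Define $\mathfrak{J}_0=\mathbb{B}$ and $\mathfrak{J}_{k+1} = \Gamma(\mathfrak{J}_k^{\,k+1})$. -}

module Defs where

open import Data.Nat using (ℕ; zero; suc; _+_)
open import Data.Bool using (Bool; true; false; if_then_else_; _∨_; _∧_; not)
open import Data.List using (List; []; _∷_; _++_)
open import Data.List.Membership.Propositional using (_∈_)
open import Data.Vec using (Vec; zipWith; replicate; map)
import Data.Vec.Properties as VecP
import Data.Bool.Properties as BoolP
open import Relation.Binary.Definitions using (DecidableEquality)
open import Relation.Binary.PropositionalEquality using (_≡_; refl; cong)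
open import Relation.Nullary using (Dec; yes; no; does)

infixr 6 _∧'_
infixr 5 _∨'_
infixr 4 _⇒_

data Fm : Set where
  var  : ℕ → Fm
  ⊥'   : Fm
  ⊤'   : Fm
  _∧'_ : Fm → Fm → Fm
  _∨'_ : Fm → Fm → Fm
  _⇒_  : Fm → Fm → Fm

¬' : Fm → Fm
¬' A = A ⇒ ⊥'

infix 2 _⊢_

data _⊢_ (Γ : List Fm) : Fm → Set where
  ax   : ∀ {A} → A ∈ Γ → Γ ⊢ A
  ⊤I   : Γ ⊢ ⊤'
  ⊥E   : ∀ {A} → Γ ⊢ ⊥' → Γ ⊢ A
  ∧I   : ∀ {A B} → Γ ⊢ A → Γ ⊢ B → Γ ⊢ A ∧' B
  ∧E₁  : ∀ {A B} → Γ ⊢ A ∧' B → Γ ⊢ A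
  ∧E₂  : ∀ {A B} → Γ ⊢ A ∧' B → Γ ⊢ B
  ∨I₁  : ∀ {A B} → Γ ⊢ A → Γ ⊢ A ∨' B
  ∨I₂  : ∀ {A B} → Γ ⊢ B → Γ ⊢ A ∨' B
  ∨E   : ∀ {A B C} → Γ ⊢ A ∨' B → (A ∷ Γ) ⊢ C → (B ∷ Γ) ⊢ C → Γ ⊢ C
  ⇒I   : ∀ {A B} → (A ∷ Γ) ⊢ B → Γ ⊢ A ⇒ B
  ⇒E   : ∀ {A B} → Γ ⊢ A ⇒ B → Γ ⊢ A → Γ ⊢ B

IPL⊢ : Fm → Set
IPL⊢ A = [] ⊢ A

data IsVar : Fm → Set where
  isVar : ∀ i → IsVar (var i)

data Basic : Fm → Set where
  b-P      : ∀ p → Basic (var p)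
  b-P⇒Q    : ∀ p q → Basic (var p ⇒ var q)
  b-P⇒Q∧R  : ∀ p q r → Basic (var p ⇒ var q ∧' var r)
  b-P⇒Q∨R  : ∀ p q r → Basic (var p ⇒ var q ∨' var r)
  b-P⇒Q⇒R  : ∀ p q r → Basic (var p ⇒ var q ⇒ var r)
  b-P⇒¬Q   : ∀ p q → Basic (var p ⇒ ¬' (var q))
  b-¬P     : ∀ p → Basic (¬' (var p))
  b-P∧Q⇒R  : ∀ p q r → Basic (var p ∧' var q ⇒ var r)
  b-P∨Q⇒R  : ∀ p q r → Basic (var p ∨' var q ⇒ var r)
  b-[P⇒Q]⇒R : ∀ p q r → Basic ((var p ⇒ var q) ⇒ var r)
  b-¬P⇒Q   : ∀ p q → Basic (¬' (var p) ⇒ var q)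

-- ConjOf K Bs : K is a conjunction (in any bracketing) whose conjuncts,
-- read left to right, are exactly the (non-conjunction) formulas in Bs.
data ConjOf : Fm → List Fm → Set where
  single : ∀ {B} → Basic B → ConjOf B (B ∷ [])
  node   : ∀ {K₁ K₂ L₁ L₂} → ConjOf K₁ L₁ → ConjOf K₂ L₂ →
           ConjOf (K₁ ∧' K₂) (L₁ ++ L₂)

dOne : Fm → ℕ
dOne ((var _ ⇒ var _) ⇒ var _) = 1
dOne ((var _ ⇒ ⊥') ⇒ var _) = 1
dOne _ = 0

dCount : List Fm → ℕ
dCount [] = 0
dCount (B ∷ Bs) = dOne B + dCount Bs

-- Heyting algebras (operations only; all algebras used below are
-- concrete, so only their operations matter) with decidable equality

record HA : Set₁ where
  field
    Carrier : Set
    𝕗 𝕥     : Carrier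
    _⊓_ _⊔_ _⟶_ : Carrier → Carrier → Carrier
    _≟_     : DecidableEquality Carrier

𝔹 : HA
𝔹 = record
  { Carrier = Bool ; 𝕗 = false ; 𝕥 = true
  ; _⊓_ = _∧_ ; _⊔_ = _∨_ ; _⟶_ = λ x y → not x ∨ y
  ; _≟_ = BoolP._≟_ }

power : HA → ℕ → HA
power H n = record
  { Carrier = Vec C n ; 𝕗 = replicate n 𝕗 ; 𝕥 = replicate n 𝕥
  ; _⊓_ = zipWith _⊓_ ; _⊔_ = zipWith _⊔_ ; _⟶_ = zipWith _⟶_
  ; _≟_ = VecP.≡-dec _≟_ }
  where open HA H renaming (Carrier to C)

data GCar (C : Set) : Set where
  inH  : C → GCar C
  star : GCar C

Γ : HA → HA
Γ H = record
  { Carrier = GCar C ; 𝕗 = inH 𝕗 ; 𝕥 = inH 𝕥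
  ; _⊓_ = meet ; _⊔_ = join ; _⟶_ = imp ; _≟_ = deq }
  where
  open HA H renaming (Carrier to C)
  isT : C → Bool
  isT x = does (x ≟ 𝕥)
  α : C → GCar C
  α z = if isT z then star else inH z
  meet : GCar C → GCar C → GCar C
  meet (inH x) (inH y) = if isT x then inH y else (if isT y then inH x else inH (x ⊓ y))
  meet (inH x) star    = if isT x then star else inH x
  meet star (inH y)    = if isT y then star else inH y
  meet star star       = star
  join : GCar C → GCar C → GCar C
  join (inH x) (inH y) = if isT x ∨ isT y then inH 𝕥 else α (x ⊔ y)
  join (inH x) star    = if isT x then inH 𝕥 else star
  join star (inH y)    = if isT y then inH 𝕥 else star
  join star star       = star
  imp : GCar C → GCar C → GCar C
  imp (inH x) (inH y) = if isT x then inH y else (if isT y then inH 𝕥 else inH (x ⟶ y))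
  imp (inH x) star    = if isT x then star else inH 𝕥
  imp star (inH y)    = inH y
  imp star star       = inH 𝕥
  deq : DecidableEquality (GCar C)
  deq (inH x) (inH y) with x ≟ y
  ... | yes refl = yes refl
  ... | no ne    = no λ { refl → ne refl }
  deq (inH x) star = no λ ()
  deq star (inH y) = no λ ()
  deq star star = yes refl

𝔍 : ℕ → HA
𝔍 zero    = 𝔹
𝔍 (suc k) = Γ (power (𝔍 k) (suc k))

V : (H : HA) → (ℕ → HA.Carrier H) → Fm → HA.Carrier H
V H I (var i)  = I i
V H I ⊥'       = HA.𝕗 H
V H I ⊤'       = HA.𝕥 H
V H I (A ∧' B) = HA._⊓_ H (V H I A) (V H I B)
V H I (A ∨' B) = HA._⊔_ H (V H I A) (V H I B)
V H I (A ⇒ B)  = HA._⟶_ H (V H I A) (V H I B)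

module Submission where

open import Defs
open import Data.Bool using (Bool; true; false)
open import Data.Bool.Properties using (∨-zeroʳ)
open import Data.Empty using (⊥; ⊥-elim)
open import Data.Fin using (Fin; zero; suc; _↑ˡ_; _↑ʳ_)
open import Data.List using (List; []; _∷_; _++_; map)
open import Data.List.Membership.Propositional using (_∈_; _∉_)
open import Data.List.Membership.Propositional.Properties using (∈-++⁺ˡ; ∈-++⁺ʳ; ∈-++⁻; ∈-map⁺)
open import Data.List.Relation.Unary.Any using (here; there; _─_)
open import Data.List.Relation.Unary.All using (All; []; _∷_)
import Data.List.Relation.Unary.All as All
open import Data.List.Relation.Unary.All.Properties using (─⁺)
open import Data.List.Relation.Unary.Unique.Propositional using (Unique)
open import Data.List.Relation.Binary.Subset.Propositional using (_⊆_)
open import Data.List.Relation.Binary.Subset.Propositional.Properties using (∷⁺ʳ; xs⊆x∷xs)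
open import Data.Nat using (ℕ; zero; suc; _+_; _≤_; _<_; z≤n; s≤s)
open import Data.Nat.Properties using (m≤n⇒m≤1+n; m<n⇒m<1+n; suc-injective; +-commutativeSemigroup)
open import Data.Nat.Induction using (<-wellFounded)
open import Algebra.Properties.CommutativeSemigroup +-commutativeSemigroup using (x∙yz≈y∙xz)
open import Data.List.Membership.DecPropositional Data.Nat._≟_ using (_∈?_)
open import Data.Product using (Σ; _×_; _,_; proj₁; proj₂)
open import Data.Sum using (_⊎_; inj₁; inj₂; [_,_]′)
import Data.Sum as Sum
open import Data.Unit using (⊤; tt)
open import Data.Vec using (Vec; []; _∷_; lookup; replicate; zipWith)
import Data.Vec as Vec
open import Data.Vec.Properties
  using (lookup-replicate; lookup-zipWith; lookup-map; lookup-++ˡ; lookup-++ʳ;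
         zipWith-identityˡ; zipWith-identityʳ; zipWith-zeroˡ; zipWith-zeroʳ;
         zipWith-replicate; zipWith-replicate₁; map-cong; map-const; ∷-injective; ∷-injectiveˡ)
open import Function using (_∘_; id)
open import Induction.WellFounded using (Acc; acc)
open import Relation.Binary.PropositionalEquality
open import Relation.Nullary using (Dec; yes; no; does; ¬_)
open import Relation.Nullary.Decidable using (_×-dec_; _⊎-dec_; _→-dec_)

-- We prove, for a list G of basic formulas with d(G) = d, atoms S
-- assumed true and a goal F (a variable or ⊥): S, G ⊢ F in NJ, or some
-- interpretation in 𝔍_d makes G and S true and F not true.  This is a
-- terminating proof search.  Forward steps (a basic non-d-formula with
-- classically true antecedents yields a new atom, a split on Q ∨ R, or ⊥)
-- recurse on the number of variables of G outside S.  When none applies, each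
-- active d-formula (P ⇒ E) ⇒ R, i.e. with R ∉ S, is handled by recursion on d:
-- G without it, plus E ⇒ R, with P assumed, has goal E.  A proof fires R;
-- otherwise a model in 𝔍_{d-1} refutes P ⇒ E, and these d models are glued
-- by Γ into a countermodel in 𝔍_d = Γ(𝔍_{d-1}^d), at whose root positive
-- formulas behave classically.  Without active d-formulas the classical
-- valuation S, embedded into 𝔍_d, is a countermodel.

module _ (H H′ : HA) where
  private
    module A = HA H
    module B = HA H′

  record IsHom (h : A.Carrier → B.Carrier) : Set where
    field
      𝕗-pres : h A.𝕗 ≡ B.𝕗
      𝕥-pres : h A.𝕥 ≡ B.𝕥
      ⊓-pres : ∀ x y → h (x A.⊓ y) ≡ h x B.⊓ h y
      ⊔-pres : ∀ x y → h (x A.⊔ y) ≡ h x B.⊔ h y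
      ⟶-pres : ∀ x y → h (x A.⟶ y) ≡ h x B.⟶ h y

V-hom : ∀ {H H′ h} → IsHom H H′ h → ∀ I A → h (V H I A) ≡ V H′ (h ∘ I) A
V-hom hom I (var p)  = refl
V-hom hom I ⊥'       = IsHom.𝕗-pres hom
V-hom hom I ⊤'       = IsHom.𝕥-pres hom
V-hom {H′ = H′} hom I (A ∧' B) =
  trans (IsHom.⊓-pres hom _ _) (cong₂ (HA._⊓_ H′) (V-hom hom I A) (V-hom hom I B))
V-hom {H′ = H′} hom I (A ∨' B) =
  trans (IsHom.⊔-pres hom _ _) (cong₂ (HA._⊔_ H′) (V-hom hom I A) (V-hom hom I B))
V-hom {H′ = H′} hom I (A ⇒ B) =
  trans (IsHom.⟶-pres hom _ _) (cong₂ (HA._⟶_ H′) (V-hom hom I A) (V-hom hom I B))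

V-cong : ∀ H {I J : ℕ → HA.Carrier H} → (∀ p → I p ≡ J p) → ∀ A → V H I A ≡ V H J A
V-cong H e (var p)  = e p
V-cong H e ⊥'       = refl
V-cong H e ⊤'       = refl
V-cong H e (A ∧' B) = cong₂ (HA._⊓_ H) (V-cong H e A) (V-cong H e B)
V-cong H e (A ∨' B) = cong₂ (HA._⊔_ H) (V-cong H e A) (V-cong H e B)
V-cong H e (A ⇒ B)  = cong₂ (HA._⟶_ H) (V-cong H e A) (V-cong H e B)

record Laws (H : HA) : Set where
  open HA H
  field
    ⊓-identityˡ : ∀ x → 𝕥 ⊓ x ≡ x
    ⊓-identityʳ : ∀ x → x ⊓ 𝕥 ≡ x
    ⊓-𝕗         : 𝕗 ⊓ 𝕗 ≡ 𝕗
    ⊓-root      : ∀ x y → x ⊓ y ≡ 𝕥 → x ≡ 𝕥 × y ≡ 𝕥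
    ⊔-zeroˡ     : ∀ x → 𝕥 ⊔ x ≡ 𝕥
    ⊔-zeroʳ     : ∀ x → x ⊔ 𝕥 ≡ 𝕥
    ⊔-𝕗         : 𝕗 ⊔ 𝕗 ≡ 𝕗
    ⟶-identityˡ : ∀ x → 𝕥 ⟶ x ≡ x
    ⟶-zeroʳ     : ∀ x → x ⟶ 𝕥 ≡ 𝕥
    ⟶-𝕗ˡ        : ∀ x → 𝕗 ⟶ x ≡ 𝕥

  ⊓-root⁻ : ∀ {x y} → x ≡ 𝕥 → y ≡ 𝕥 → x ⊓ y ≡ 𝕥
  ⊓-root⁻ refl refl = ⊓-identityˡ 𝕥

  ⟶-mp : ∀ {x y} → x ⟶ y ≡ 𝕥 → x ≡ 𝕥 → y ≡ 𝕥
  ⟶-mp {y = y} e refl = trans (sym (⟶-identityˡ y)) e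

  ⊔-root⁻ : ∀ {x y} → x ≡ 𝕥 ⊎ y ≡ 𝕥 → x ⊔ y ≡ 𝕥
  ⊔-root⁻ (inj₁ refl) = ⊔-zeroˡ _
  ⊔-root⁻ (inj₂ refl) = ⊔-zeroʳ _

Nontrivial : HA → Set
Nontrivial H = ¬ HA.𝕗 H ≡ HA.𝕥 H

laws-𝔹 : Laws 𝔹
laws-𝔹 = record
  { ⊓-identityˡ = λ _ → refl
  ; ⊓-identityʳ = λ { true → refl ; false → refl }
  ; ⊓-𝕗 = refl
  ; ⊓-root = λ { true true _ → refl , refl ; true false () ; false _ () }
  ; ⊔-zeroˡ = λ _ → refl
  ; ⊔-zeroʳ = λ { true → refl ; false → refl }
  ; ⊔-𝕗 = refl
  ; ⟶-identityˡ = λ _ → refl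
  ; ⟶-zeroʳ = λ { true → refl ; false → refl }
  ; ⟶-𝕗ˡ = λ _ → refl }

nontrivial-𝔹 : Nontrivial 𝔹
nontrivial-𝔹 ()

module _ {H : HA} (L : Laws H) where
  open HA H
  open Laws L

  embed : Bool → Carrier
  embed true  = 𝕥
  embed false = 𝕗

  embed-hom : IsHom 𝔹 H embed
  embed-hom = record
    { 𝕗-pres = refl ; 𝕥-pres = refl
    ; ⊓-pres = λ { true y → sym (⊓-identityˡ (embed y))
                 ; false true → sym (⊓-identityʳ 𝕗) ; false false → sym ⊓-𝕗 }
    ; ⊔-pres = λ { true y → sym (⊔-zeroˡ (embed y))
                 ; false true → sym (⊔-zeroʳ 𝕗) ; false false → sym ⊔-𝕗 }
    ; ⟶-pres = λ { true y → sym (⟶-identityˡ (embed y)) ; false y → sym (⟶-𝕗ˡ (embed y)) } }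

  laws-power : ∀ n → Laws (power H n)
  laws-power n = record
    { ⊓-identityˡ = zipWith-identityˡ ⊓-identityˡ
    ; ⊓-identityʳ = zipWith-identityʳ ⊓-identityʳ
    ; ⊓-𝕗 = trans (zipWith-replicate _⊓_ 𝕗 𝕗) (cong (replicate n) ⊓-𝕗)
    ; ⊓-root = root
    ; ⊔-zeroˡ = zipWith-zeroˡ ⊔-zeroˡ
    ; ⊔-zeroʳ = zipWith-zeroʳ ⊔-zeroʳ
    ; ⊔-𝕗 = trans (zipWith-replicate _⊔_ 𝕗 𝕗) (cong (replicate n) ⊔-𝕗)
    ; ⟶-identityˡ = zipWith-identityˡ ⟶-identityˡ
    ; ⟶-zeroʳ = zipWith-zeroʳ ⟶-zeroʳ
    ; ⟶-𝕗ˡ = λ y → trans (zipWith-replicate₁ _⟶_ 𝕗 y) (trans (map-cong ⟶-𝕗ˡ y) (map-const y 𝕥)) }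
    where
    root : ∀ {m} (x y : Vec Carrier m) → zipWith _⊓_ x y ≡ replicate m 𝕥 →
           x ≡ replicate m 𝕥 × y ≡ replicate m 𝕥
    root [] [] _ = refl , refl
    root (x ∷ xs) (y ∷ ys) e with ∷-injective e
    ... | e₀ , e′ = cong₂ _∷_ (proj₁ (⊓-root x y e₀)) (proj₁ (root xs ys e′))
                  , cong₂ _∷_ (proj₂ (⊓-root x y e₀)) (proj₂ (root xs ys e′))

nontrivial-power : ∀ H n → Nontrivial H → Nontrivial (power H (suc n))
nontrivial-power H n nt = nt ∘ ∷-injectiveˡ

≡-replicate : ∀ {A : Set} {n} (v : Vec A n) {x} → (∀ j → lookup v j ≡ x) → v ≡ replicate n x
≡-replicate []      h = refl
≡-replicate (y ∷ v) h = cong₂ _∷_ (h zero) (≡-replicate v (h ∘ suc))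

lookup-hom : ∀ {H} {n} (j : Fin n) → IsHom (power H n) H (λ v → lookup v j)
lookup-hom {H} j = record
  { 𝕗-pres = lookup-replicate j (HA.𝕗 H)
  ; 𝕥-pres = lookup-replicate j (HA.𝕥 H)
  ; ⊓-pres = lookup-zipWith (HA._⊓_ H) j
  ; ⊔-pres = lookup-zipWith (HA._⊔_ H) j
  ; ⟶-pres = lookup-zipWith (HA._⟶_ H) j }

-- The construction Γ adds a new element ⋆ just below the top.
module ΓAlgebra {H : HA} (L : Laws H) where
  open HA H
  open Laws L
  private module ΓH = HA (Γ H)

  private
    does-𝕥≟𝕥 : does (𝕥 ≟ 𝕥) ≡ true
    does-𝕥≟𝕥 with 𝕥 ≟ 𝕥
    ... | yes _ = refl
    ... | no ne = ⊥-elim (ne refl)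

  inH-injective : ∀ {x y} → inH {Carrier} x ≡ inH y → x ≡ y
  inH-injective refl = refl

  -- collapsing ⋆ onto the top: the view of Γ H from above the root
  π : GCar Carrier → Carrier
  π (inH x) = x
  π star    = 𝕥

  π-hom : IsHom (Γ H) H π
  π-hom = record { 𝕗-pres = refl ; 𝕥-pres = refl ; ⊓-pres = meet ; ⊔-pres = join ; ⟶-pres = imp }
    where
    meet : ∀ a b → π (a ΓH.⊓ b) ≡ π a ⊓ π b
    meet (inH x) (inH y) with x ≟ 𝕥 | y ≟ 𝕥
    ... | yes refl | _      = sym (⊓-identityˡ y)
    ... | no _ | yes refl   = sym (⊓-identityʳ x)
    ... | no _ | no _       = refl
    meet (inH x) star with x ≟ 𝕥
    ... | yes refl = sym (⊓-identityˡ 𝕥)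
    ... | no _     = sym (⊓-identityʳ x)
    meet star (inH y) with y ≟ 𝕥
    ... | yes refl = sym (⊓-identityˡ 𝕥)
    ... | no _     = sym (⊓-identityˡ y)
    meet star star = sym (⊓-identityˡ 𝕥)
    join : ∀ a b → π (a ΓH.⊔ b) ≡ π a ⊔ π b
    join (inH x) (inH y) with x ≟ 𝕥 | y ≟ 𝕥
    ... | yes refl | _    = sym (⊔-zeroˡ y)
    ... | no _ | yes refl = sym (⊔-zeroʳ x)
    ... | no _ | no _ with (x ⊔ y) ≟ 𝕥
    ...   | yes e = sym e
    ...   | no _  = refl
    join (inH x) star with x ≟ 𝕥
    ... | yes refl = sym (⊔-zeroˡ 𝕥)
    ... | no _     = sym (⊔-zeroʳ x)
    join star (inH y) with y ≟ 𝕥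
    ... | yes refl = sym (⊔-zeroˡ 𝕥)
    ... | no _     = sym (⊔-zeroˡ y)
    join star star = sym (⊔-zeroˡ 𝕥)
    imp : ∀ a b → π (a ΓH.⟶ b) ≡ π a ⟶ π b
    imp (inH x) (inH y) with x ≟ 𝕥 | y ≟ 𝕥
    ... | yes refl | _    = sym (⟶-identityˡ y)
    ... | no _ | yes refl = sym (⟶-zeroʳ x)
    ... | no _ | no _     = refl
    imp (inH x) star with x ≟ 𝕥
    ... | yes refl = sym (⟶-identityˡ 𝕥)
    ... | no _     = sym (⟶-zeroʳ x)
    imp star (inH y) = sym (⟶-identityˡ y)
    imp star star    = sym (⟶-identityˡ 𝕥)

  ⊓-root-Γ : ∀ a b → a ΓH.⊓ b ≡ ΓH.𝕥 → a ≡ ΓH.𝕥 × b ≡ ΓH.𝕥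
  ⊓-root-Γ (inH x) (inH y) e with x ≟ 𝕥 | y ≟ 𝕥
  ... | yes refl | _    = refl , e
  ... | no nx | yes refl = ⊥-elim (nx (inH-injective e))
  ... | no nx | no _     = ⊥-elim (nx (proj₁ (⊓-root x y (inH-injective e))))
  ⊓-root-Γ (inH x) star e with x ≟ 𝕥
  ⊓-root-Γ (inH x) star () | yes _
  ... | no nx = ⊥-elim (nx (inH-injective e))
  ⊓-root-Γ star (inH y) e with y ≟ 𝕥
  ⊓-root-Γ star (inH y) () | yes _
  ... | no ny = ⊥-elim (ny (inH-injective e))
  ⊓-root-Γ star star ()

  ⊔-root-Γ : ∀ a b → a ΓH.⊔ b ≡ ΓH.𝕥 → a ≡ ΓH.𝕥 ⊎ b ≡ ΓH.𝕥
  ⊔-root-Γ (inH x) (inH y) e with x ≟ 𝕥 | y ≟ 𝕥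
  ... | yes refl | _     = inj₁ refl
  ... | no _ | yes refl  = inj₂ refl
  ... | no _ | no _ with (x ⊔ y) ≟ 𝕥
  ⊔-root-Γ (inH x) (inH y) () | no _ | no _ | yes _
  ...   | no nxy = ⊥-elim (nxy (inH-injective e))
  ⊔-root-Γ (inH x) star e with x ≟ 𝕥
  ... | yes refl = inj₁ refl
  ⊔-root-Γ (inH x) star () | no _
  ⊔-root-Γ star (inH y) e with y ≟ 𝕥
  ... | yes refl = inj₂ refl
  ⊔-root-Γ star (inH y) () | no _
  ⊔-root-Γ star star ()

  ⟶-root-Γ : ∀ a b → (a ≡ ΓH.𝕥 → b ≡ ΓH.𝕥) → π a ⟶ π b ≡ 𝕥 → a ΓH.⟶ b ≡ ΓH.𝕥
  ⟶-root-Γ (inH x) (inH y) f e with x ≟ 𝕥 | y ≟ 𝕥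
  ... | yes refl | _    = f refl
  ... | no _ | yes refl = refl
  ... | no _ | no _     = cong inH e
  ⟶-root-Γ (inH x) star f e with x ≟ 𝕥
  ... | yes refl = f refl
  ... | no _     = refl
  ⟶-root-Γ star (inH y) f e = cong inH (trans (sym (⟶-identityˡ y)) e)
  ⟶-root-Γ star star f e    = refl

  ⊓-identityˡ-Γ : ∀ y → ΓH.𝕥 ΓH.⊓ y ≡ y
  ⊓-identityˡ-Γ (inH y) rewrite does-𝕥≟𝕥 = refl
  ⊓-identityˡ-Γ star    rewrite does-𝕥≟𝕥 = refl

  ⊓-identityʳ-Γ : ∀ y → y ΓH.⊓ ΓH.𝕥 ≡ y
  ⊓-identityʳ-Γ (inH y) with y ≟ 𝕥
  ... | yes refl = refl
  ... | no _ rewrite does-𝕥≟𝕥 = refl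
  ⊓-identityʳ-Γ star rewrite does-𝕥≟𝕥 = refl

  ⊔-zeroˡ-Γ : ∀ y → ΓH.𝕥 ΓH.⊔ y ≡ ΓH.𝕥
  ⊔-zeroˡ-Γ (inH y) rewrite does-𝕥≟𝕥 = refl
  ⊔-zeroˡ-Γ star    rewrite does-𝕥≟𝕥 = refl

  ⊔-zeroʳ-Γ : ∀ y → y ΓH.⊔ ΓH.𝕥 ≡ ΓH.𝕥
  ⊔-zeroʳ-Γ (inH y) rewrite does-𝕥≟𝕥 | ∨-zeroʳ (does (y ≟ 𝕥)) = refl
  ⊔-zeroʳ-Γ star    rewrite does-𝕥≟𝕥 = refl

  ⟶-identityˡ-Γ : ∀ y → ΓH.𝕥 ΓH.⟶ y ≡ y
  ⟶-identityˡ-Γ (inH y) rewrite does-𝕥≟𝕥 = refl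
  ⟶-identityˡ-Γ star    rewrite does-𝕥≟𝕥 = refl

  ⟶-zeroʳ-Γ : ∀ y → y ΓH.⟶ ΓH.𝕥 ≡ ΓH.𝕥
  ⟶-zeroʳ-Γ (inH y) rewrite does-𝕥≟𝕥 with y ≟ 𝕥
  ... | yes _ = refl
  ... | no _  = refl
  ⟶-zeroʳ-Γ star = refl

  -- the facts about 𝕗 need 𝕗 ≢ 𝕥 in H, so that 𝕗 stays below the new element
  module _ (nt : Nontrivial H) where
    private
      does-𝕗≟𝕥 : does (𝕗 ≟ 𝕥) ≡ false
      does-𝕗≟𝕥 with 𝕗 ≟ 𝕥
      ... | yes e = ⊥-elim (nt e)
      ... | no _  = refl

    ⊓-𝕗-Γ : ΓH.𝕗 ΓH.⊓ ΓH.𝕗 ≡ ΓH.𝕗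
    ⊓-𝕗-Γ rewrite does-𝕗≟𝕥 = cong inH ⊓-𝕗

    ⊔-𝕗-Γ : ΓH.𝕗 ΓH.⊔ ΓH.𝕗 ≡ ΓH.𝕗
    ⊔-𝕗-Γ rewrite does-𝕗≟𝕥 | ⊔-𝕗 | does-𝕗≟𝕥 = refl

    ⟶-𝕗ˡ-Γ : ∀ y → ΓH.𝕗 ΓH.⟶ y ≡ ΓH.𝕥
    ⟶-𝕗ˡ-Γ (inH y) rewrite does-𝕗≟𝕥 with y ≟ 𝕥
    ... | yes _ = refl
    ... | no _  = cong inH (⟶-𝕗ˡ y)
    ⟶-𝕗ˡ-Γ star rewrite does-𝕗≟𝕥 = refl

    laws-Γ : Laws (Γ H)
    laws-Γ = record
      { ⊓-identityˡ = ⊓-identityˡ-Γ ; ⊓-identityʳ = ⊓-identityʳ-Γ ; ⊓-𝕗 = ⊓-𝕗-Γ ; ⊓-root = ⊓-root-Γ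
      ; ⊔-zeroˡ = ⊔-zeroˡ-Γ ; ⊔-zeroʳ = ⊔-zeroʳ-Γ ; ⊔-𝕗 = ⊔-𝕗-Γ
      ; ⟶-identityˡ = ⟶-identityˡ-Γ ; ⟶-zeroʳ = ⟶-zeroʳ-Γ ; ⟶-𝕗ˡ = ⟶-𝕗ˡ-Γ }

nontrivial-Γ : ∀ H → Nontrivial H → Nontrivial (Γ H)
nontrivial-Γ H nt refl = nt refl

𝔍-nontrivial : ∀ k → Nontrivial (𝔍 k)
𝔍-nontrivial zero    = nontrivial-𝔹
𝔍-nontrivial (suc k) =
  nontrivial-Γ (power (𝔍 k) (suc k)) (nontrivial-power (𝔍 k) k (𝔍-nontrivial k))

𝔍-laws : ∀ k → Laws (𝔍 k)
𝔍-laws zero    = laws-𝔹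
𝔍-laws (suc k) =
  ΓAlgebra.laws-Γ (laws-power (𝔍-laws k) (suc k)) (nontrivial-power (𝔍 k) k (𝔍-nontrivial k))

weaken : ∀ {Γ Δ A} → Γ ⊆ Δ → Γ ⊢ A → Δ ⊢ A
weaken s (ax m)     = ax (s m)
weaken s ⊤I         = ⊤I
weaken s (⊥E d)     = ⊥E (weaken s d)
weaken s (∧I d e)   = ∧I (weaken s d) (weaken s e)
weaken s (∧E₁ d)    = ∧E₁ (weaken s d)
weaken s (∧E₂ d)    = ∧E₂ (weaken s d)
weaken s (∨I₁ d)    = ∨I₁ (weaken s d)
weaken s (∨I₂ d)    = ∨I₂ (weaken s d)
weaken s (∨E d e f) = ∨E (weaken s d) (weaken (∷⁺ʳ _ s) e) (weaken (∷⁺ʳ _ s) f)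
weaken s (⇒I d)     = ⇒I (weaken (∷⁺ʳ _ s) d)
weaken s (⇒E d e)   = ⇒E (weaken s d) (weaken s e)

_⊩_ : List Fm → List Fm → Set
Δ ⊩ Γ = ∀ {A} → A ∈ Γ → Δ ⊢ A

⊩-keep : ∀ {Γ Δ B} → Δ ⊩ Γ → (B ∷ Δ) ⊩ (B ∷ Γ)
⊩-keep σ (here refl) = ax (here refl)
⊩-keep σ (there m)   = weaken (xs⊆x∷xs _ _) (σ m)

substitute : ∀ {Γ Δ A} → Δ ⊩ Γ → Γ ⊢ A → Δ ⊢ A
substitute σ (ax m)     = σ m
substitute σ ⊤I         = ⊤I
substitute σ (⊥E d)     = ⊥E (substitute σ d)
substitute σ (∧I d e)   = ∧I (substitute σ d) (substitute σ e)
substitute σ (∧E₁ d)    = ∧E₁ (substitute σ d)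
substitute σ (∧E₂ d)    = ∧E₂ (substitute σ d)
substitute σ (∨I₁ d)    = ∨I₁ (substitute σ d)
substitute σ (∨I₂ d)    = ∨I₂ (substitute σ d)
substitute σ (∨E d e f) = ∨E (substitute σ d) (substitute (⊩-keep σ) e) (substitute (⊩-keep σ) f)
substitute σ (⇒I d)     = ⇒I (substitute (⊩-keep σ) d)
substitute σ (⇒E d e)   = ⇒E (substitute σ d) (substitute σ e)

⊩-++ : ∀ {Δ Γ₁ Γ₂} → Δ ⊩ Γ₁ → Δ ⊩ Γ₂ → Δ ⊩ (Γ₁ ++ Γ₂)
⊩-++ {Γ₁ = Γ₁} σ τ m with ∈-++⁻ Γ₁ m
... | inj₁ m₁ = σ m₁
... | inj₂ m₂ = τ m₂

Ctx : List ℕ → List Fm → List Fm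
Ctx S G = map var S ++ G

from-G : ∀ {S G B} → B ∈ G → Ctx S G ⊢ B
from-G {S} m = ax (∈-++⁺ʳ (map var S) m)

from-S : ∀ {S G p} → p ∈ S → Ctx S G ⊢ var p
from-S m = ax (∈-++⁺ˡ (∈-map⁺ var m))

T : List ℕ → Fm → Set
T S (var p)  = p ∈ S
T S ⊥'       = ⊥
T S ⊤'       = ⊤
T S (A ∧' B) = T S A × T S B
T S (A ∨' B) = T S A ⊎ T S B
T S (A ⇒ B)  = T S A → T S B

varsF : Fm → List ℕ
varsF (var p)  = p ∷ []
varsF ⊥'       = []
varsF ⊤'       = []
varsF (A ∧' B) = varsF A ++ varsF B
varsF (A ∨' B) = varsF A ++ varsF B
varsF (A ⇒ B)  = varsF A ++ varsF B

varsL : List Fm → List ℕ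
varsL []       = []
varsL (B ∷ G)  = varsF B ++ varsL G

varsF⊆varsL : ∀ {G B} → B ∈ G → varsF B ⊆ varsL G
varsF⊆varsL {B′ ∷ G} (here refl) = ∈-++⁺ˡ
varsF⊆varsL {B′ ∷ G} (there m)   = ∈-++⁺ʳ (varsF B′) ∘ varsF⊆varsL m

-- The termination measure of the search: the entries of xs that are not in S.
bump : ∀ {P : Set} → Dec P → ℕ → ℕ
bump (yes _) n = n
bump (no _)  n = suc n

unmarked : List ℕ → List ℕ → ℕ
unmarked S []       = 0
unmarked S (x ∷ xs) = bump (x ∈? S) (unmarked S xs)

-- Here p decides membership in the larger set of atoms and q in the smaller.
bump-mono : ∀ {P Q : Set} {m n} (p : Dec P) (q : Dec Q) → (Q → P) → m ≤ n → bump p m ≤ bump q n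
bump-mono (yes _) (yes _) f h = h
bump-mono (yes _) (no _)  f h = m≤n⇒m≤1+n h
bump-mono (no ¬p) (yes q) f h = ⊥-elim (¬p (f q))
bump-mono (no _)  (no _)  f h = s≤s h

bump-strict : ∀ {P Q : Set} {m n} (p : Dec P) (q : Dec Q) → (Q → P) → m < n → bump p m < bump q n
bump-strict (yes _) (yes _) f h = h
bump-strict (yes _) (no _)  f h = m<n⇒m<1+n h
bump-strict (no ¬p) (yes q) f h = ⊥-elim (¬p (f q))
bump-strict (no _)  (no _)  f h = s≤s h

bump-new : ∀ {P Q : Set} {m n} (p : Dec P) (q : Dec Q) → P → ¬ Q → m ≤ n → bump p m < bump q n
bump-new _       (yes q) p′ ¬q h = ⊥-elim (¬q q)
bump-new (yes _) (no _)  p′ ¬q h = s≤s h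
bump-new (no ¬p) (no _)  p′ ¬q h = ⊥-elim (¬p p′)

unmarked-mono : ∀ a S xs → unmarked (a ∷ S) xs ≤ unmarked S xs
unmarked-mono a S []       = z≤n
unmarked-mono a S (x ∷ xs) = bump-mono (x ∈? a ∷ S) (x ∈? S) there (unmarked-mono a S xs)

unmarked-strict : ∀ {a S xs} → a ∉ S → a ∈ xs → unmarked (a ∷ S) xs < unmarked S xs
unmarked-strict {a} {S} {x ∷ xs} a∉S (here refl) =
  bump-new (x ∈? a ∷ S) (x ∈? S) (here refl) a∉S (unmarked-mono a S xs)
unmarked-strict {a} {S} {x ∷ xs} a∉S (there m) =
  bump-strict (x ∈? a ∷ S) (x ∈? S) there (unmarked-strict a∉S m)

T? : ∀ S A → Dec (T S A)
T? S (var p)  = p ∈? S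
T? S ⊥'       = no λ ()
T? S ⊤'       = yes tt
T? S (A ∧' B) = T? S A ×-dec T? S B
T? S (A ∨' B) = T? S A ⊎-dec T? S B
T? S (A ⇒ B)  = T? S A →-dec T? S B

data Pos : Fm → Set where
  pos-var : ∀ p → Pos (var p)
  pos-⊥   : Pos ⊥'
  pos-∧   : ∀ {A B} → Pos A → Pos B → Pos (A ∧' B)
  pos-∨   : ∀ {A B} → Pos A → Pos B → Pos (A ∨' B)

-- Conclusions of the basic formulas that are not d-formulas.
data Head : Fm → Set where
  head-var : ∀ q → Head (var q)
  head-⊥   : Head ⊥'
  head-∧   : ∀ q r → Head (var q ∧' var r)
  head-∨   : ∀ q r → Head (var q ∨' var r)

head-pos : ∀ {C} → Head C → Pos C
head-pos (head-var q) = pos-var q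
head-pos head-⊥       = pos-⊥
head-pos (head-∧ q r) = pos-∧ (pos-var q) (pos-var r)
head-pos (head-∨ q r) = pos-∨ (pos-var q) (pos-var r)

data Imp : Fm → Set where
  conc : ∀ {C} → Head C → Imp C
  prem : ∀ {A B} → Pos A → Imp B → Imp (A ⇒ B)

data DF : Fm → Set where
  df-var : ∀ p e r → DF ((var p ⇒ var e) ⇒ var r)
  df-⊥   : ∀ p r → DF ((var p ⇒ ⊥') ⇒ var r)

-- The antecedent of an implication (only applied to d-formulas).
antecedent : Fm → Fm
antecedent (A ⇒ _) = A
antecedent _       = ⊤'

module _ {B : Fm} where
  premise : DF B → ℕ
  premise (df-var p e r) = p
  premise (df-⊥ p r)     = p

  inner : DF B → Fm
  inner (df-var p e r) = var e
  inner (df-⊥ p r)     = ⊥'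

  concl : DF B → ℕ
  concl (df-var p e r) = r
  concl (df-⊥ p r)     = r

  -- the formula E ⇒ R made available when proving the left premise P ⇒ E
  extra : DF B → List Fm
  extra (df-var p e r) = (var e ⇒ var r) ∷ []
  extra (df-⊥ p r)     = []

basic-shape : ∀ {B} → Basic B → Imp B ⊎ DF B
basic-shape (b-P p)           = inj₁ (conc (head-var p))
basic-shape (b-P⇒Q p q)       = inj₁ (prem (pos-var p) (conc (head-var q)))
basic-shape (b-P⇒Q∧R p q r)   = inj₁ (prem (pos-var p) (conc (head-∧ q r)))
basic-shape (b-P⇒Q∨R p q r)   = inj₁ (prem (pos-var p) (conc (head-∨ q r)))
basic-shape (b-P⇒Q⇒R p q r)   = inj₁ (prem (pos-var p) (prem (pos-var q) (conc (head-var r))))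
basic-shape (b-P⇒¬Q p q)      = inj₁ (prem (pos-var p) (prem (pos-var q) (conc head-⊥)))
basic-shape (b-¬P p)          = inj₁ (prem (pos-var p) (conc head-⊥))
basic-shape (b-P∧Q⇒R p q r)   = inj₁ (prem (pos-∧ (pos-var p) (pos-var q)) (conc (head-var r)))
basic-shape (b-P∨Q⇒R p q r)   = inj₁ (prem (pos-∨ (pos-var p) (pos-var q)) (conc (head-var r)))
basic-shape (b-[P⇒Q]⇒R p q r) = inj₂ (df-var p q r)
basic-shape (b-¬P⇒Q p q)      = inj₂ (df-⊥ p q)

imp-not-df : ∀ {B} → Imp B → ¬ DF B
imp-not-df (conc ())   (df-var _ _ _)
imp-not-df (prem () _) (df-var _ _ _)
imp-not-df (conc ())   (df-⊥ _ _)
imp-not-df (prem () _) (df-⊥ _ _)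

imp-dOne : ∀ {B} → Imp B → dOne B ≡ 0
imp-dOne (conc (head-var q))            = refl
imp-dOne (conc head-⊥)                  = refl
imp-dOne (conc (head-∧ q r))            = refl
imp-dOne (conc (head-∨ q r))            = refl
imp-dOne (prem (pos-var p) _)           = refl
imp-dOne (prem pos-⊥ _)                 = refl
imp-dOne (prem (pos-∧ _ _) _)           = refl
imp-dOne (prem (pos-∨ _ _) _)           = refl

Active : List ℕ → Fm → Set
Active S B = Σ (DF B) λ δ → concl δ ∉ S

inactive : ∀ {S B} (δ : DF B) → concl δ ∈ S → ¬ Active S B
inactive (df-var p e r) r∈S (df-var _ _ _ , r∉S) = r∉S r∈S
inactive (df-⊥ p r)     r∈S (df-⊥ _ _ , r∉S)     = r∉S r∈S

df-true : ∀ {S B} (δ : DF B) → concl δ ∈ S → T S B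
df-true (df-var p e r) r∈S _ = r∈S
df-true (df-⊥ p r)     r∈S _ = r∈S

concl∈vars : ∀ {B} (δ : DF B) → concl δ ∈ varsF B
concl∈vars (df-var p e r) = there (there (here refl))
concl∈vars (df-⊥ p r)     = there (here refl)

remove⊆ : ∀ {B : Fm} {G} (m : B ∈ G) → (G ─ m) ⊆ G
remove⊆ (here _)  k         = there k
remove⊆ (there m) (here e)  = here e
remove⊆ (there m) (there k) = there (remove⊆ m k)

∈-remove : ∀ {B x : Fm} {G} (m : B ∈ G) → x ∈ G → x ≡ B ⊎ x ∈ (G ─ m)
∈-remove (here refl) (here refl) = inj₁ refl
∈-remove (here refl) (there k)   = inj₂ k
∈-remove (there m)   (here refl) = inj₂ (here refl)
∈-remove (there m)   (there k)   = Sum.map₂ there (∈-remove m k)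

dCount-remove : ∀ {B G} (m : B ∈ G) → dCount G ≡ dOne B + dCount (G ─ m)
dCount-remove (here refl) = refl
dCount-remove {B} {C ∷ G} (there m) = begin
  dOne C + dCount G                    ≡⟨ cong (dOne C +_) (dCount-remove m) ⟩
  dOne C + (dOne B + dCount (G ─ m))   ≡⟨ x∙yz≈y∙xz (dOne C) (dOne B) _ ⟩
  dOne B + (dOne C + dCount (G ─ m))   ∎
  where open ≡-Reasoning

Goal : Fm → Set
Goal F = IsVar F ⊎ F ≡ ⊥'

goal-pos : ∀ {F} → Goal F → Pos F
goal-pos (inj₁ (isVar f)) = pos-var f
goal-pos (inj₂ refl)      = pos-⊥

goal? : ∀ {G F} S → Goal F → (Ctx S G ⊢ F) ⊎ ¬ T S F
goal? S (inj₁ (isVar f)) with f ∈? S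
... | yes f∈S = inj₁ (from-S f∈S)
... | no f∉S  = inj₂ f∉S
goal? S (inj₂ refl) = inj₂ id

data Step (G : List Fm) (S : List ℕ) : Set where
  contra : Ctx S G ⊢ ⊥' → Step G S
  fire   : ∀ a → a ∉ S → a ∈ varsL G → Ctx S G ⊢ var a → Step G S
  split  : ∀ q r → q ∉ S → r ∉ S → q ∈ varsL G → r ∈ varsL G →
           Ctx S G ⊢ var q ∨' var r → Step G S

pos-derivable : ∀ {S G A} → Pos A → T S A → Ctx S G ⊢ A
pos-derivable (pos-var p) p∈S      = from-S p∈S
pos-derivable pos-⊥ ()
pos-derivable (pos-∧ a b) (ta , tb) = ∧I (pos-derivable a ta) (pos-derivable b tb)
pos-derivable (pos-∨ a b) (inj₁ ta) = ∨I₁ (pos-derivable a ta)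
pos-derivable (pos-∨ a b) (inj₂ tb) = ∨I₂ (pos-derivable b tb)

head-step : ∀ {S G C} → Head C → varsF C ⊆ varsL G → Ctx S G ⊢ C → ¬ T S C → Step G S
head-step (head-var q) vs d ¬t = fire q ¬t (vs (here refl)) d
head-step head-⊥       vs d ¬t = contra d
head-step {S} (head-∧ q r) vs d ¬t with q ∈? S
... | no q∉S  = fire q q∉S (vs (here refl)) (∧E₁ d)
... | yes q∈S = fire r (λ r∈S → ¬t (q∈S , r∈S)) (vs (there (here refl))) (∧E₂ d)
head-step (head-∨ q r) vs d ¬t =
  split q r (¬t ∘ inj₁) (¬t ∘ inj₂) (vs (here refl)) (vs (there (here refl))) d

imp-step : ∀ {S G B} → Imp B → varsF B ⊆ varsL G → Ctx S G ⊢ B → Step G S ⊎ T S B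
imp-step {S} (conc {C} h) vs d with T? S C
... | yes t = inj₂ t
... | no ¬t = inj₁ (head-step h vs d ¬t)
imp-step {S} (prem {A} a i) vs d with T? S A
... | no ¬t = inj₂ (⊥-elim ∘ ¬t)
... | yes t = Sum.map₂ (λ t′ _ → t′) (imp-step i (vs ∘ ∈-++⁺ʳ (varsF A)) (⇒E d (pos-derivable a t)))

Saturated : List Fm → List ℕ → Set
Saturated G S = ∀ {B} → B ∈ G → T S B ⊎ Active S B

status : ∀ {S G B} → Basic B → B ∈ G → Step G S ⊎ (T S B ⊎ Active S B)
status {S} b m with basic-shape b
... | inj₁ i = Sum.map₂ inj₁ (imp-step i (varsF⊆varsL m) (from-G m))
... | inj₂ δ with concl δ ∈? S
...   | yes r∈S = inj₂ (inj₁ (df-true δ r∈S))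
...   | no r∉S  = inj₂ (inj₂ (δ , r∉S))

first-exit : ∀ {X E : Set} {P : X → Set} xs →
  (∀ {x} → x ∈ xs → E ⊎ P x) → E ⊎ (∀ {x} → x ∈ xs → P x)
first-exit [] f = inj₂ λ ()
first-exit (x ∷ xs) f with f (here refl) | first-exit xs (f ∘ there)
... | inj₁ e  | _         = inj₁ e
... | inj₂ _  | inj₁ e    = inj₁ e
... | inj₂ px | inj₂ pxs  = inj₂ λ { (here refl) → px ; (there m) → pxs m }

saturate : ∀ {S G} → All Basic G → Step G S ⊎ Saturated G S
saturate {G = G} bs = first-exit G (λ m → status (All.lookup bs m) m)

active-or-true : ∀ {S G} → Saturated G S → (Σ Fm λ B → B ∈ G × Active S B) ⊎ (∀ {B} → B ∈ G → T S B)
active-or-true {G = G} sat = first-exit G (λ m → Sum.swap (Sum.map₂ (λ a → _ , m , a) (sat m)))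

-- The problem for the left premise P ⇒ E of a d-formula B ∈ G:
-- drop B, add E ⇒ R, assume P and prove E.
residual : ∀ {B G} → DF B → B ∈ G → List Fm
residual {G = G} δ m = extra δ ++ (G ─ m)

extra-derivable : ∀ {S G B} (δ : DF B) → B ∈ G → Ctx S G ⊩ extra δ
extra-derivable (df-var p e r) m (here refl) =
  ⇒I (⇒E (weaken (xs⊆x∷xs _ _) (from-G m)) (⇒I (ax (there (here refl)))))

left-proof : ∀ {S G B} (δ : DF B) (m : B ∈ G) →
  Ctx (premise δ ∷ S) (residual δ m) ⊢ inner δ → Ctx S G ⊢ var (concl δ)
left-proof {S} δ m d = ⇒E (shape δ) (⇒I (substitute (⊩-keep residual-derivable) d))
  where
  shape : ∀ (δ : DF _) → Ctx S _ ⊢ (var (premise δ) ⇒ inner δ) ⇒ var (concl δ)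
  shape (df-var p e r) = from-G m
  shape (df-⊥ p r)     = from-G m
  residual-derivable : Ctx S _ ⊩ (map var S ++ residual δ m)
  residual-derivable = ⊩-++ {Γ₁ = map var S} (ax ∘ ∈-++⁺ˡ)
    (⊩-++ {Γ₁ = extra δ} (extra-derivable δ m) (ax ∘ ∈-++⁺ʳ (map var S) ∘ remove⊆ m))

residual-basic : ∀ {G B} (δ : DF B) (m : B ∈ G) → All Basic G → All Basic (residual δ m)
residual-basic (df-var p e r) m bs = b-P⇒Q e r ∷ ─⁺ m bs
residual-basic (df-⊥ p r)     m bs = ─⁺ m bs

residual-dCount : ∀ {d G B} (δ : DF B) (m : B ∈ G) → dCount G ≡ suc d → dCount (residual δ m) ≡ d
residual-dCount (df-var p e r) m eq = suc-injective (trans (sym (dCount-remove m)) eq)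
residual-dCount (df-⊥ p r)     m eq = suc-injective (trans (sym (dCount-remove m)) eq)

inner-goal : ∀ {B} (δ : DF B) → Goal (inner δ)
inner-goal (df-var p e r) = inj₁ (isVar e)
inner-goal (df-⊥ p r)     = inj₂ refl

no-d-formula : ∀ {G B} → dCount G ≡ 0 → B ∈ G → ¬ DF B
no-d-formula eq m (df-var p e r) with trans (sym (dCount-remove m)) eq
... | ()
no-d-formula eq m (df-⊥ p r) with trans (sym (dCount-remove m)) eq
... | ()

Holds : (H : HA) → (ℕ → HA.Carrier H) → Fm → Set
Holds H I A = V H I A ≡ HA.𝕥 H

record Model (H : HA) (G : List Fm) (S : List ℕ) : Set where
  constructor model
  field
    val   : ℕ → HA.Carrier H
    sat   : ∀ {B} → B ∈ G → Holds H val B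
    atoms : ∀ {p} → p ∈ S → Holds H val (var p)

record CounterModel (H : HA) (G : List Fm) (S : List ℕ) (A : Fm) : Set where
  constructor countermodel
  field
    base  : Model H G S
    fails : ¬ Holds H (Model.val base) A

χ : List ℕ → ℕ → Bool
χ S p = does (p ∈? S)

classical : ∀ S A → (T S A × V 𝔹 (χ S) A ≡ true) ⊎ (¬ T S A × V 𝔹 (χ S) A ≡ false)
classical S (var p) with p ∈? S
... | yes p∈S = inj₁ (p∈S , refl)
... | no p∉S  = inj₂ (p∉S , refl)
classical S ⊥' = inj₂ ((λ ()) , refl)
classical S ⊤' = inj₁ (tt , refl)
classical S (A ∧' B) with classical S A | classical S B
... | inj₁ (a , ea) | inj₁ (b , eb) rewrite ea | eb = inj₁ ((a , b) , refl)
... | inj₁ (_ , ea) | inj₂ (b , eb) rewrite ea | eb = inj₂ (b ∘ proj₂ , refl)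
... | inj₂ (a , ea) | _             rewrite ea      = inj₂ (a ∘ proj₁ , refl)
classical S (A ∨' B) with classical S A | classical S B
... | inj₁ (a , ea) | _             rewrite ea      = inj₁ (inj₁ a , refl)
... | inj₂ (_ , ea) | inj₁ (b , eb) rewrite ea | eb = inj₁ (inj₂ b , refl)
... | inj₂ (a , ea) | inj₂ (b , eb) rewrite ea | eb =
  inj₂ ((λ { (inj₁ x) → a x ; (inj₂ y) → b y }) , refl)
classical S (A ⇒ B) with classical S A | classical S B
... | inj₁ (a , ea) | inj₁ (b , eb) rewrite ea | eb = inj₁ ((λ _ → b) , refl)
... | inj₁ (a , ea) | inj₂ (b , eb) rewrite ea | eb = inj₂ ((λ f → b (f a)) , refl)
... | inj₂ (a , ea) | _             rewrite ea      = inj₁ ((⊥-elim ∘ a) , refl)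

LeftRefutation : HA → List Fm → List ℕ → Fm → Set
LeftRefutation H G S B = CounterModel H G S (antecedent B)

classical-countermodel : ∀ {H G S F} → Laws H → Nontrivial H →
  (∀ {B} → B ∈ G → T S B) → ¬ T S F → CounterModel H G S F
classical-countermodel {H} {G} {S} {F} L nt true-G false-F =
  countermodel (model I (λ m → holds (true-G m)) (λ {p} → holds {var p})) refuted
  where
  I : ℕ → HA.Carrier H
  I = embed L ∘ χ S
  value : ∀ A → V H I A ≡ embed L (V 𝔹 (χ S) A)
  value A = sym (V-hom (embed-hom L) (χ S) A)
  holds : ∀ {A} → T S A → Holds H I A
  holds {A} t with classical S A
  ... | inj₁ (_ , e) = trans (value A) (cong (embed L) e)
  ... | inj₂ (¬t , _) = ⊥-elim (¬t t)
  refuted : ¬ Holds H I F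
  refuted h with classical S F
  ... | inj₁ (t , _) = false-F t
  ... | inj₂ (_ , e) = nt (trans (sym (trans (value F) (cong (embed L) e))) h)

module _ {H : HA} (L : Laws H) where
  open HA H
  open Laws L

  restore : ∀ {B G I} (m : B ∈ G) → Holds H I B → (∀ {x} → x ∈ (G ─ m) → Holds H I x) →
            ∀ {x} → x ∈ G → Holds H I x
  restore m hB hG k with ∈-remove m k
  ... | inj₁ refl = hB
  ... | inj₂ k′   = hG k′

  left-refutation : ∀ {G S B} (δ : DF B) (m : B ∈ G) →
    CounterModel H (residual δ m) (premise δ ∷ S) (inner δ) → LeftRefutation H G S B
  left-refutation (df-var p e r) m (countermodel (model I holds atoms) ¬e) =
    countermodel (model I (restore m hB (holds ∘ there)) (atoms ∘ there)) λ h → ¬e (⟶-mp h p-true)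
    where
    p-true : I p ≡ 𝕥
    p-true = atoms (here refl)
    hB : (I p ⟶ I e) ⟶ I r ≡ 𝕥
    hB rewrite p-true | ⟶-identityˡ (I e) = holds (here refl)
  left-refutation (df-⊥ p r) m (countermodel (model I holds atoms) ¬⊥) =
    countermodel (model I (restore m hB holds) (atoms ∘ there)) λ h → ¬⊥ (⟶-mp h p-true)
    where
    p-true : I p ≡ 𝕥
    p-true = atoms (here refl)
    hB : (I p ⟶ 𝕗) ⟶ I r ≡ 𝕥
    hB rewrite p-true | ⟶-identityˡ 𝕗 = ⟶-𝕗ˡ (I r)

Covers : ∀ H {G S n} → Vec (Model H G S) n → Fm → Set
Covers H {n = n} cs B = Σ (Fin n) λ j → ¬ Holds H (Model.val (lookup cs j)) (antecedent B)

module Glue {H : HA} (L : Laws H) {n} (nt : Nontrivial (power H n))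
            {G : List Fm} {S : List ℕ} (models : Vec (Model H G S) n) where
  open HA H using (Carrier; 𝕥)
  private
    P = power H n
    module P = HA P
    ΓP = Γ P
    module ΓP = HA ΓP
  open Laws L using (⟶-mp)
  open ΓAlgebra (laws-power L n)
    using (π; π-hom; ⊓-root-Γ; ⊔-root-Γ; ⟶-root-Γ; inH-injective; laws-Γ)
  open Laws (laws-Γ nt) using (⊓-root⁻; ⊔-root⁻)

  column : ℕ → Vec Carrier n
  column p = Vec.map (λ M → Model.val M p) models

  -- a variable true in every model but not in S must not be true at the root
  raise : Vec Carrier n → GCar (Vec Carrier n)
  raise v with v P.≟ P.𝕥
  ... | yes _ = star
  ... | no _  = inH v

  I : ℕ → ΓP.Carrier
  I p with p ∈? S
  ... | yes _ = ΓP.𝕥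
  ... | no _  = raise (column p)

  column-S : ∀ {p} → p ∈ S → column p ≡ P.𝕥
  column-S p∈S = trans (map-cong (λ M → Model.atoms M p∈S) models) (map-const models 𝕥)

  π-raise : ∀ v → π (raise v) ≡ v
  π-raise v with v P.≟ P.𝕥
  ... | yes e = sym e
  ... | no _  = refl

  π-I : ∀ p → π (I p) ≡ column p
  π-I p with p ∈? S
  ... | yes p∈S = sym (column-S p∈S)
  ... | no _    = π-raise (column p)

  raise-not-top : ∀ v → ¬ raise v ≡ ΓP.𝕥
  raise-not-top v e with v P.≟ P.𝕥
  raise-not-top v () | yes _
  ... | no v≢𝕥 = v≢𝕥 (inH-injective e)

  I-top : ∀ {p} → I p ≡ ΓP.𝕥 → p ∈ S
  I-top {p} e with p ∈? S
  ... | yes p∈S = p∈S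
  ... | no _    = ⊥-elim (raise-not-top (column p) e)

  I-top⁻ : ∀ {p} → p ∈ S → I p ≡ ΓP.𝕥
  I-top⁻ {p} p∈S with p ∈? S
  ... | yes _   = refl
  ... | no p∉S  = ⊥-elim (p∉S p∈S)

  Forced : Fm → Set
  Forced A = Holds ΓP I A

  InModel : Fin n → Fm → Set
  InModel j A = Holds H (Model.val (lookup models j)) A

  -- below the root, the glued model is the product of the given models
  component : ∀ A j → lookup (π (V ΓP I A)) j ≡ V H (Model.val (lookup models j)) A
  component A j = begin
    lookup (π (V ΓP I A)) j                 ≡⟨ cong (λ v → lookup v j) (V-hom π-hom I A) ⟩
    lookup (V P (π ∘ I) A) j               ≡⟨ V-hom (lookup-hom j) (π ∘ I) A ⟩
    V H (λ p → lookup (π (I p)) j) A       ≡⟨ V-cong H column-j A ⟩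
    V H (Model.val (lookup models j)) A        ∎
    where
    open ≡-Reasoning
    column-j : ∀ p → lookup (π (I p)) j ≡ Model.val (lookup models j) p
    column-j p = trans (cong (λ v → lookup v j) (π-I p)) (lookup-map j _ models)

  forced⇒models : ∀ {A} → Forced A → ∀ j → InModel j A
  forced⇒models {A} f j =
    trans (sym (component A j)) (trans (cong (λ a → lookup (π a) j) f) (lookup-replicate j 𝕥))

  models⇒π-top : ∀ {A} → (∀ j → InModel j A) → π (V ΓP I A) ≡ P.𝕥
  models⇒π-top {A} h = ≡-replicate _ (λ j → trans (component A j) (h j))

  forced-⇒ : ∀ A B → (∀ j → InModel j (A ⇒ B)) → (Forced A → Forced B) → Forced (A ⇒ B)
  forced-⇒ A B h f =
    ⟶-root-Γ _ _ f (trans (sym (IsHom.⟶-pres π-hom (V ΓP I A) (V ΓP I B))) (models⇒π-top {A ⇒ B} h))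

  pos-forced : ∀ {A} → Pos A → Forced A → T S A
  pos-forced (pos-var p) f = I-top f
  pos-forced pos-⊥       f = nt (inH-injective f)
  pos-forced (pos-∧ a b) f with ⊓-root-Γ _ _ f
  ... | fa , fb = pos-forced a fa , pos-forced b fb
  pos-forced (pos-∨ a b) f with ⊔-root-Γ _ _ f
  ... | inj₁ fa = inj₁ (pos-forced a fa)
  ... | inj₂ fb = inj₂ (pos-forced b fb)

  pos-forced⁻ : ∀ {A} → Pos A → T S A → Forced A
  pos-forced⁻ (pos-var p) t         = I-top⁻ t
  pos-forced⁻ pos-⊥       ()
  pos-forced⁻ (pos-∧ a b) (ta , tb) = ⊓-root⁻ (pos-forced⁻ a ta) (pos-forced⁻ b tb)
  pos-forced⁻ (pos-∨ {A} {B} a b) (inj₁ ta) = ⊔-root⁻ {y = V ΓP I B} (inj₁ (pos-forced⁻ a ta))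
  pos-forced⁻ (pos-∨ {A} {B} a b) (inj₂ tb) = ⊔-root⁻ {x = V ΓP I A} (inj₂ (pos-forced⁻ b tb))

  imp-forced : ∀ {A} → Imp A → (∀ j → InModel j A) → T S A → Forced A
  imp-forced (conc h)   _ t = pos-forced⁻ (head-pos h) t
  imp-forced (prem {A} {B} a i) h t = forced-⇒ A B h λ fa →
    imp-forced i (λ j → ⟶-mp (h j) (forced⇒models {A} fa j)) (t (pos-forced a fa))

  conclusion-forced : ∀ A {r} → r ∈ S ⊎ Σ (Fin n) (λ j → ¬ InModel j A) → Forced A → Forced (var r)
  conclusion-forced A (inj₁ r∈S)      _  = I-top⁻ r∈S
  conclusion-forced A (inj₂ (j , ¬h)) fa = ⊥-elim (¬h (forced⇒models {A} fa j))

  df-forced : ∀ {B} (δ : DF B) → (∀ j → InModel j B) →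
              concl δ ∈ S ⊎ Σ (Fin n) (λ j → ¬ InModel j (antecedent B)) → Forced B
  df-forced (df-var p e r) h c =
    forced-⇒ (var p ⇒ var e) (var r) h (conclusion-forced (var p ⇒ var e) c)
  df-forced (df-⊥ p r) h c =
    forced-⇒ (var p ⇒ ⊥') (var r) h (conclusion-forced (var p ⇒ ⊥') c)

  in-models : ∀ {B} → B ∈ G → ∀ j → InModel j B
  in-models m j = Model.sat (lookup models j) m

  glued-countermodel : ∀ {F} → All Basic G → Saturated G S →
    (∀ {B} → B ∈ G → Active S B → Covers H models B) →
    Pos F → ¬ T S F → CounterModel (Γ (power H n)) G S F
  glued-countermodel bs sat covers pF ¬F =
    countermodel (model I forced-G I-top⁻) (¬F ∘ pos-forced pF)
    where
    forced-G : ∀ {B} → B ∈ G → Forced B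
    forced-G m with basic-shape (All.lookup bs m) | sat m
    ... | inj₁ i | inj₁ t       = imp-forced i (in-models m) t
    ... | inj₁ i | inj₂ (δ , _) = ⊥-elim (imp-not-df i δ)
    ... | inj₂ δ | _ with concl δ ∈? S
    ...   | yes r∈S = df-forced δ (in-models m) (inj₁ r∈S)
    ...   | no r∉S  = df-forced δ (in-models m) (inj₂ (covers m (δ , r∉S)))

-- Assembling one model per d-formula of G: its left refutation when it is
-- active, the default model M₀ otherwise.
module Components {H : HA} {G : List Fm} {S : List ℕ} (M₀ : Model H G S) where

  covers-++ˡ : ∀ {k l} (xs : Vec (Model H G S) k) (ys : Vec (Model H G S) l) B →
               Covers H xs B → Covers H (xs Vec.++ ys) B
  covers-++ˡ xs ys B (j , ¬h) =
    j ↑ˡ _ , subst (λ M → ¬ Holds H (Model.val M) (antecedent B)) (sym (lookup-++ˡ xs ys j)) ¬h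

  covers-++ʳ : ∀ {k l} (xs : Vec (Model H G S) k) (ys : Vec (Model H G S) l) B →
               Covers H ys B → Covers H (xs Vec.++ ys) B
  covers-++ʳ {k} xs ys B (j , ¬h) =
    k ↑ʳ j , subst (λ M → ¬ Holds H (Model.val M) (antecedent B)) (sym (lookup-++ʳ xs ys j)) ¬h

  Covering : List Fm → ℕ → Set
  Covering xs n = Σ (Vec (Model H G S) n) λ cs → ∀ {B} → B ∈ xs → Active S B → Covers H cs B

  one-component : ∀ {B} (δ : DF B) → (Active S B → LeftRefutation H G S B) → Covering (B ∷ []) 1
  one-component δ ρ with concl δ ∈? S
  ... | yes r∈S = (M₀ ∷ []) , λ { (here refl) a → ⊥-elim (inactive δ r∈S a) }
  ... | no r∉S  = (CounterModel.base ρ′ ∷ []) , λ { (here refl) _ → zero , CounterModel.fails ρ′ }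
    where ρ′ = ρ (δ , r∉S)

  components-of : ∀ {B} → Basic B → (Active S B → LeftRefutation H G S B) →
                  Covering (B ∷ []) (dOne B)
  components-of b ρ with basic-shape b
  ... | inj₁ i = subst (Covering _) (sym (imp-dOne i))
                   ([] , λ { (here refl) a → ⊥-elim (imp-not-df i (proj₁ a)) })
  ... | inj₂ (df-var p e r) = one-component (df-var p e r) ρ
  ... | inj₂ (df-⊥ p r)     = one-component (df-⊥ p r) ρ

  components : ∀ xs → All Basic xs → (∀ {B} → B ∈ xs → Active S B → LeftRefutation H G S B) →
               Covering xs (dCount xs)
  components []       []       ρ = [] , λ ()
  components (B ∷ xs) (b ∷ bs) ρ with components-of b (ρ (here refl)) | components xs bs (ρ ∘ there)
  ... | c , cc | cs , ccs = c Vec.++ cs , λ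
    { (here refl) a → covers-++ˡ c cs B (cc (here refl) a)
    ; {B′} (there m) a → covers-++ʳ c cs B′ (ccs m a) }

Result : HA → List Fm → List ℕ → Fm → Set
Result H G S F = (Ctx S G ⊢ F) ⊎ CounterModel H G S F

forget-atom : ∀ {H G S F a} → CounterModel H G (a ∷ S) F → CounterModel H G S F
forget-atom (countermodel (model I holds atoms) ¬F) =
  countermodel (model I holds (atoms ∘ there)) ¬F

perform : ∀ {H G S F} → Step G S →
  (∀ a → a ∉ S → a ∈ varsL G → Result H G (a ∷ S) F) → Result H G S F
perform (contra d) _ = inj₁ (⊥E d)
perform (fire a a∉S a∈G d) solve with solve a a∉S a∈G
... | inj₁ d′ = inj₁ (⇒E (⇒I d′) d)
... | inj₂ c  = inj₂ (forget-atom c)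
perform (split q r q∉S r∉S q∈G r∈G d) solve with solve q q∉S q∈G | solve r r∉S r∈G
... | inj₁ dq | inj₁ dr = inj₁ (∨E d dq dr)
... | inj₂ c  | _       = inj₂ (forget-atom c)
... | inj₁ _  | inj₂ c  = inj₂ (forget-atom c)

Solvable : ℕ → Set
Solvable d = ∀ {G} → All Basic G → dCount G ≡ d → ∀ {F} → Goal F → ∀ S → Result (𝔍 d) G S F

Finisher : ℕ → Set
Finisher d = ∀ {G S F} → All Basic G → dCount G ≡ d → Pos F → ¬ T S F → Saturated G S →
             Step G S ⊎ CounterModel (𝔍 d) G S F

search : ∀ {d} → Finisher d → ∀ {G} → All Basic G → dCount G ≡ d → ∀ {F} → Goal F →
         ∀ S → Acc _<_ (unmarked S (varsL G)) → Result (𝔍 d) G S F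
search finish bs eq goal S (acc smaller) with goal? S goal
... | inj₁ d = inj₁ d
... | inj₂ ¬F with [ inj₁ , finish bs eq (goal-pos goal) ¬F ]′ (saturate bs)
...   | inj₂ c    = inj₂ c
...   | inj₁ step = perform step λ a a∉S a∈G →
          search finish bs eq goal (a ∷ S) (smaller (unmarked-strict a∉S a∈G))

left-premise : ∀ {d G S B} → Solvable d → All Basic G → dCount G ≡ suc d → B ∈ G → (δ : DF B) →
  (Ctx S G ⊢ var (concl δ)) ⊎ LeftRefutation (𝔍 d) G S B
left-premise {d} {S = S} solve bs eq m δ =
  Sum.map (left-proof δ m) (left-refutation (𝔍-laws d) δ m)
    (solve (residual-basic δ m bs) (residual-dCount δ m eq) (inner-goal δ) (premise δ ∷ S))

probe : ∀ {d G S B} → Solvable d → All Basic G → dCount G ≡ suc d → B ∈ G →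
  Step G S ⊎ (Active S B → LeftRefutation (𝔍 d) G S B)
probe {S = S} solve bs eq m with basic-shape (All.lookup bs m)
... | inj₁ i = inj₂ (⊥-elim ∘ imp-not-df i ∘ proj₁)
... | inj₂ δ with concl δ ∈? S
...   | yes r∈S = inj₂ (⊥-elim ∘ inactive δ r∈S)
...   | no r∉S  = Sum.map (fire (concl δ) r∉S (varsF⊆varsL m (concl∈vars δ))) (λ ρ _ → ρ)
                    (left-premise solve bs eq m δ)

glue : ∀ {d G S F} → All Basic G → dCount G ≡ suc d → Pos F → ¬ T S F → Saturated G S →
  Model (𝔍 d) G S → (∀ {B} → B ∈ G → Active S B → LeftRefutation (𝔍 d) G S B) →
  CounterModel (𝔍 (suc d)) G S F
glue {d} {G} {S} {F} bs eq pF ¬F sat M₀ refuted with Components.components M₀ G bs refuted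
... | cs , covered = subst (λ k → CounterModel (Γ (power (𝔍 d) k)) G S F) eq
        (Glue.glued-countermodel (𝔍-laws d) nontrivial cs bs sat covered pF ¬F)
  where
  nontrivial : Nontrivial (power (𝔍 d) (dCount G))
  nontrivial = subst (λ k → Nontrivial (power (𝔍 d) k)) (sym eq)
                 (nontrivial-power (𝔍 d) d (𝔍-nontrivial d))

-- For d = 0 there are no d-formulas, so a saturated G is classically true.
finish-zero : Finisher 0
finish-zero bs eq pF ¬F sat with active-or-true sat
... | inj₁ (B , m , δ , _) = ⊥-elim (no-d-formula eq m δ)
... | inj₂ true-G         = inj₂ (classical-countermodel (𝔍-laws 0) (𝔍-nontrivial 0) true-G ¬F)

finish-suc : ∀ {d} → Solvable d → Finisher (suc d)
finish-suc {d} solve {G} bs eq pF ¬F sat with first-exit G (probe solve bs eq)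
... | inj₁ step = inj₁ step
... | inj₂ refuted with active-or-true sat
...   | inj₂ true-G =
        inj₂ (classical-countermodel (𝔍-laws (suc d)) (𝔍-nontrivial (suc d)) true-G ¬F)
...   | inj₁ (B , m , a) = inj₂ (glue bs eq pF ¬F sat (CounterModel.base (refuted m a)) refuted)

solvable : ∀ d → Solvable d
solvable zero    bs eq goal S = search finish-zero bs eq goal S (<-wellFounded _)
solvable (suc d) bs eq goal S = search (finish-suc (solvable d)) bs eq goal S (<-wellFounded _)

conjuncts-derivable : ∀ {K Bs Δ} → ConjOf K Bs → Δ ⊢ K → Δ ⊩ Bs
conjuncts-derivable (single _) d (here refl) = d
conjuncts-derivable (node {L₁ = L₁} c₁ c₂) d =
  ⊩-++ {Γ₁ = L₁} (conjuncts-derivable c₁ (∧E₁ d)) (conjuncts-derivable c₂ (∧E₂ d))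

conjunction-holds : ∀ {H I K Bs} → Laws H → ConjOf K Bs →
  (∀ {B} → B ∈ Bs → Holds H I B) → Holds H I K
conjunction-holds L (single _) h = h (here refl)
conjunction-holds L (node {L₁ = L₁} c₁ c₂) h =
  Laws.⊓-root⁻ L (conjunction-holds L c₁ (h ∘ ∈-++⁺ˡ)) (conjunction-holds L c₂ (h ∘ ∈-++⁺ʳ L₁))

theorem1 : (K F : Fm) (Bs : List Fm) →
    ConjOf K Bs → All Basic Bs → Unique Bs → (IsVar F ⊎ F ≡ ⊥') →
    IPL⊢ (K ⇒ F)
    ⊎ Σ (ℕ → HA.Carrier (𝔍 (dCount Bs)))
        (λ I → (V (𝔍 (dCount Bs)) I K ≡ HA.𝕥 (𝔍 (dCount Bs)))
             × ¬ (V (𝔍 (dCount Bs)) I F ≡ HA.𝕥 (𝔍 (dCount Bs))))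
theorem1 K F Bs conj basic _ goal with solvable (dCount Bs) basic refl goal []
... | inj₁ proof = inj₁ (⇒I (substitute (conjuncts-derivable conj (ax (here refl))) proof))
... | inj₂ (countermodel (model I sat _) fails) =
  inj₂ (I , conjunction-holds (𝔍-laws (dCount Bs)) conj sat , fails)
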